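{- Let $P$ be a finite poset with a minimum $\hat 0$ and a maximum $\hat 1$, and let $\varphi:P\rightarrow P$ be an increasing map. Let $\varphi^\infty:=\varphi^{|P|}$ and $\varphi^{ -\infty}(\hat 1):=\{z\in P:\varphi^\infty(z)=\hat 1\}$. Let $Q$ be a subset of $P$ (with the induced order) such that $P\supseteq Q\supseteq\mathrm{Fix}\,\varphi$ and $Q\cap\varphi^{ -\infty}(\hat 1)=\{\hat 1\}$. Then \[ \sum_{z\in P,\ \varphi^\infty(z)=\hat 1}\mu_P(\hat 0,z)= \begin{cases} \mu_Q(\hat 0,\hat 1),&\text{ if } \hat 0\in\mathrm{Fix}\,\varphi;\\ 0,&\text{ otherwise}. \end{cases} \]
   Context: An increasing map of a poset $P$ is an order-preserving map $\varphi:P\rightarrow P$ with $x\leq\varphi(x)$ for all $x\in P$. $\mathrm{Fix}\,\varphi$ is the set of fixed points of $\varphi$. $\mu_P$ denotes the Möbius function of the poset $P$, and $\mu_Q$ that of the induced subposet $Q$. -}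

module Defs where

open import Data.Nat using (ℕ; zero; suc)
open import Data.Fin using (Fin; zero; suc)
open import Data.Fin.Properties using (_≟_)
open import Data.Bool using (Bool; true; false; if_then_else_; _∧_; not)
open import Data.Integer using (ℤ; -_; _+_; 0ℤ; 1ℤ)
open import Relation.Binary using (Rel; Decidable)
open import Relation.Nullary using (yes; no)
open import Relation.Nullary.Decidable using (⌊_⌋)
open import Level using (0ℓ)

sumFin : {n : ℕ} → (Fin n → ℤ) → ℤ
sumFin {zero}  f = 0ℤ
sumFin {suc n} f = f zero + sumFin (λ i → f (suc i))

iter : {A : Set} → (A → A) → ℕ → A → A
iter f zero    x = x
iter f (suc k) x = f (iter f k x)

-- The natural-number argument
-- is fuel for the recursion; fuel n (the size of the poset) is always
-- sufficient since every strict chain has fewer than n steps.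
mobiusFuel : {n : ℕ} {_≤_ : Rel (Fin n) 0ℓ} → Decidable _≤_ →
             (S : Fin n → Bool) → ℕ → Fin n → Fin n → ℤ
mobiusFuel _≤?_ S k x y with x ≟ y
... | yes _ = 1ℤ
mobiusFuel _≤?_ S zero x y | no _ = 0ℤ
mobiusFuel _≤?_ S (suc k) x y | no _ =
  if ⌊ x ≤? y ⌋
  then - sumFin (λ z → if S z ∧ ⌊ x ≤? z ⌋ ∧ ⌊ z ≤? y ⌋ ∧ not ⌊ z ≟ y ⌋
                       then mobiusFuel _≤?_ S k x z
                       else 0ℤ)
  else 0ℤ

-- Möbius function μ_S of the induced subposet on S (meaningful for x, y ∈ S).
mobiusSub : {n : ℕ} {_≤_ : Rel (Fin n) 0ℓ} → Decidable _≤_ →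
            (S : Fin n → Bool) → Fin n → Fin n → ℤ
mobiusSub {n} _≤?_ S = mobiusFuel _≤?_ S n

mobius : {n : ℕ} {_≤_ : Rel (Fin n) 0ℓ} → Decidable _≤_ → Fin n → Fin n → ℤ
mobius _≤?_ = mobiusSub _≤?_ (λ _ → true)

{-# OPTIONS --safe #-}
-- Since strict chains in P have fewer than |P| elements, φ^∞ maps P into
-- Fix φ, and for a fixed point y we have φ^∞ z ≤ y ⇔ z ≤ y. Hence, for every S ⊇ Fix φ, the
-- pushforward F_S(x) = Σ_{z ∈ S, φ^∞ z = x} μ_S(0̂, z) satisfies, for every y ∈ Fix φ,
--   Σ_{x ∈ Fix φ, x ≤ y} F_S(x) = Σ_{z ∈ S, z ≤ y} μ_S(0̂, z) = δ(0̂, y).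
-- This triangular system on Fix φ has at most one solution, so F_P(1̂) = F_Q(1̂), and the
-- hypothesis on Q collapses F_Q(1̂) to μ_Q(0̂, 1̂). If 0̂ is not fixed, the right-hand side
-- vanishes on Fix φ, so F_P vanishes there as well.
module Submission where

open import Data.Bool using (Bool; true; false; if_then_else_; _∧_; not)
open import Data.Bool.Properties using (∧-assoc; ∧-identityʳ; ∧-zeroʳ; ∧-conicalˡ; ∧-conicalʳ; T-≡)
open import Data.Empty using (⊥; ⊥-elim)
open import Data.Fin using (Fin; zero; suc)
open import Data.Fin.Induction using (po-wellFounded)
open import Data.Fin.Properties using (_≟_; punchInᵢ≢i)
open import Data.Fin.Subset using (Subset; _∈_; _⊆_; ∣_∣)
open import Data.Fin.Subset.Properties using (p⊂q⇒∣p∣<∣q∣; ∣⊤∣≡n; ∈⊤)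
open import Data.Integer using (ℤ; 0ℤ; 1ℤ; _+_; -_)
import Data.Integer.Properties as ℤ
open import Algebra.Properties.AbelianGroup ℤ.+-0-abelianGroup using (∙-cancelʳ)
open import Algebra.Properties.CommutativeMonoid.Sum ℤ.+-0-commutativeMonoid
  using (sum; sum-cong-≗; sum-replicate-zero; sum-remove; ∑-distrib-+; ∑-comm)
open import Data.Nat as ℕ using (ℕ; zero; suc)
import Data.Nat.Properties as ℕₚ
open import Data.Product using (_×_; _,_)
open import Data.Sum using (_⊎_; inj₁; inj₂)
open import Data.Vec using (tabulate)
open import Data.Vec.Functional using (removeAt)
open import Data.Vec.Properties using (lookup∘tabulate; []=⇒lookup; lookup⇒[]=)
open import Defs
open import Function using (_∘_; Equivalence; _⇔_; mk⇔)
open import Induction.WellFounded using (Acc; acc)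
open import Level using (0ℓ)
open import Relation.Binary using (Rel)
import Relation.Binary.Construct.NonStrictToStrict as ToStrict
open import Relation.Binary.PropositionalEquality
  using (_≡_; _≢_; refl; sym; trans; cong; cong₂; subst; module ≡-Reasoning)
open import Relation.Binary.Structures using (IsDecPartialOrder)
open import Relation.Nullary using (Dec; yes; no; ¬_)
open import Relation.Nullary.Decidable using (⌊_⌋; toWitness; fromWitness; does-⇔; isYes≗does)

⌊⌋-true : ∀ {a} {A : Set a} (a? : Dec A) → A → ⌊ a? ⌋ ≡ true
⌊⌋-true a? = Equivalence.to T-≡ ∘ fromWitness

⌊⌋-true⁻¹ : ∀ {a} {A : Set a} (a? : Dec A) → ⌊ a? ⌋ ≡ true → A
⌊⌋-true⁻¹ a? = toWitness ∘ Equivalence.from T-≡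

⌊⌋-⇔ : ∀ {a b} {A : Set a} {B : Set b} → A ⇔ B → (a? : Dec A) (b? : Dec B) → ⌊ a? ⌋ ≡ ⌊ b? ⌋
⌊⌋-⇔ A⇔B a? b? = trans (isYes≗does a?) (trans (does-⇔ A⇔B a? b?) (sym (isYes≗does b?)))

sumFin≡sum : ∀ {n} (f : Fin n → ℤ) → sumFin f ≡ sum f
sumFin≡sum {zero}  f = refl
sumFin≡sum {suc n} f = cong (f zero +_) (sumFin≡sum (f ∘ suc))

sumFin-cong : ∀ {n} {f g : Fin n → ℤ} → (∀ i → f i ≡ g i) → sumFin f ≡ sumFin g
sumFin-cong {f = f} {g} f≗g = trans (sumFin≡sum f) (trans (sum-cong-≗ f≗g) (sym (sumFin≡sum g)))

sum-supported-at : ∀ {n} (f : Fin n → ℤ) w → (∀ x → x ≢ w → f x ≡ 0ℤ) → sum f ≡ f w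
sum-supported-at {suc n} f w vanish = begin
  sum f                     ≡⟨ sum-remove f ⟩
  f w + sum (removeAt f w)  ≡⟨ cong (f w +_) (sum-cong-≗ (λ i → vanish _ (punchInᵢ≢i w i))) ⟩
  f w + sum {n} (λ _ → 0ℤ)  ≡⟨ cong (f w +_) (sum-replicate-zero n) ⟩
  f w + 0ℤ                  ≡⟨ ℤ.+-identityʳ (f w) ⟩
  f w                       ∎
  where open ≡-Reasoning

infixr 7 [_]·_

[_]·_ : Bool → ℤ → ℤ
[ b ]· x = if b then x else 0ℤ

[]·-zero : ∀ b → [ b ]· 0ℤ ≡ 0ℤ
[]·-zero true  = refl
[]·-zero false = refl

[]·-cong : ∀ b {x y} → (b ≡ true → x ≡ y) → [ b ]· x ≡ [ b ]· y
[]·-cong true  x≡y = x≡y refl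
[]·-cong false _   = refl

[]·-∧ : ∀ a b x → [ a ∧ b ]· x ≡ [ b ]· [ a ]· x
[]·-∧ true  b x = refl
[]·-∧ false b x = sym ([]·-zero b)

[]·-vanish : ∀ b {x} → ¬ b ≡ true → [ b ]· x ≡ 0ℤ
[]·-vanish true  b≢true = ⊥-elim (b≢true refl)
[]·-vanish false _      = refl

[]·-sum : ∀ {n} b (f : Fin n → ℤ) → [ b ]· sum f ≡ sum (λ i → [ b ]· f i)
[]·-sum true  f = refl
[]·-sum {n} false f = sym (sum-replicate-zero n)

sum-delta : ∀ {n} (f : Fin n → ℤ) w → sum (λ z → [ ⌊ z ≟ w ⌋ ]· f z) ≡ f w
sum-delta f w = trans (sum-supported-at _ w off-w) at-w
  where
  off-w : ∀ z → z ≢ w → [ ⌊ z ≟ w ⌋ ]· f z ≡ 0ℤ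
  off-w z z≢w with z ≟ w
  ... | yes z≡w = ⊥-elim (z≢w z≡w)
  ... | no _    = refl
  at-w : [ ⌊ w ≟ w ⌋ ]· f w ≡ f w
  at-w with w ≟ w
  ... | yes _   = refl
  ... | no w≢w  = ⊥-elim (w≢w refl)

module FiniteDecPoset {n : ℕ} {_≤_ : Rel (Fin n) 0ℓ} (po : IsDecPartialOrder _≡_ _≤_) where

  open IsDecPartialOrder po using (_≤?_; antisym; isPartialOrder) renaming (refl to ≤-refl; trans to ≤-trans)
  open ToStrict _≡_ _≤_ using (_<_; <-irrefl)

  <-trans : ∀ {x y z} → x < y → y < z → x < z
  <-trans = ToStrict.<-trans _≡_ _≤_ isPartialOrder

  -- The strictness test spelled exactly as in mobiusFuel, so that its sums match ours
  -- definitionally; ⌊ x <? y ⌋ would not reduce to this, since ⌊_⌋ is not a projection.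
  _<ᵇ_ : Fin n → Fin n → Bool
  x <ᵇ y = ⌊ x ≤? y ⌋ ∧ not ⌊ x ≟ y ⌋

  <ᵇ⇒< : ∀ {x y} → x <ᵇ y ≡ true → x < y
  <ᵇ⇒< {x} {y} _ with x ≤? y | x ≟ y
  ... | yes x≤y | no x≢y = x≤y , x≢y
  <ᵇ⇒< {x} {y} () | yes _ | yes _
  <ᵇ⇒< {x} {y} () | no _  | _

  <⇒<ᵇ : ∀ {x y} → x < y → x <ᵇ y ≡ true
  <⇒<ᵇ {x} {y} (x≤y , x≢y) with x ≤? y | x ≟ y
  ... | yes _   | no _    = refl
  ... | yes _   | yes x≡y = ⊥-elim (x≢y x≡y)
  ... | no x≰y  | _       = ⊥-elim (x≰y x≤y)

  strictlyBelow : Fin n → Subset n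
  strictlyBelow y = tabulate (_<ᵇ y)

  ∈-strictlyBelow⁺ : ∀ {x y} → x < y → x ∈ strictlyBelow y
  ∈-strictlyBelow⁺ {x} x<y = lookup⇒[]= x _ (trans (lookup∘tabulate _ x) (<⇒<ᵇ x<y))

  ∈-strictlyBelow⁻ : ∀ {x y} → x ∈ strictlyBelow y → x < y
  ∈-strictlyBelow⁻ {x} x∈ = <ᵇ⇒< (trans (sym (lookup∘tabulate _ x)) ([]=⇒lookup x∈))

  ∉-strictlyBelow-self : ∀ y → y ∈ strictlyBelow y → ⊥
  ∉-strictlyBelow-self y = <-irrefl refl ∘ ∈-strictlyBelow⁻

  height : Fin n → ℕ
  height y = ∣ strictlyBelow y ∣

  height-mono : ∀ {x y} → x < y → height x ℕ.< height y
  height-mono {x} {y} x<y = p⊂q⇒∣p∣<∣q∣ (below-x⊆below-y , x , ∈-strictlyBelow⁺ x<y , ∉-strictlyBelow-self x)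
    where
    below-x⊆below-y : strictlyBelow x ⊆ strictlyBelow y
    below-x⊆below-y w∈ = ∈-strictlyBelow⁺ (<-trans (∈-strictlyBelow⁻ w∈) x<y)

  height<n : ∀ y → height y ℕ.< n
  height<n y = subst (height y ℕ.<_) (∣⊤∣≡n n) (p⊂q⇒∣p∣<∣q∣ ((λ _ → ∈⊤) , y , ∈⊤ , ∉-strictlyBelow-self y))

  zeta strictZeta : (Fin n → Bool) → (Fin n → ℤ) → Fin n → ℤ
  zeta       C u y = sum (λ x → [ C x ∧ ⌊ x ≤? y ⌋ ]· u x)
  strictZeta C u y = sum (λ x → [ C x ∧ x <ᵇ y ]· u x)

  zeta-split : ∀ C u y → zeta C u y ≡ [ C y ]· u y + strictZeta C u y
  zeta-split C u y = begin
    sum (λ x → [ C x ∧ ⌊ x ≤? y ⌋ ]· u x)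
      ≡⟨ sum-cong-≗ split-at-y ⟩
    sum (λ x → [ ⌊ x ≟ y ⌋ ]· [ C x ]· u x + [ C x ∧ x <ᵇ y ]· u x)
      ≡⟨ ∑-distrib-+ (λ x → [ ⌊ x ≟ y ⌋ ]· [ C x ]· u x) (λ x → [ C x ∧ x <ᵇ y ]· u x) ⟩
    sum (λ x → [ ⌊ x ≟ y ⌋ ]· [ C x ]· u x) + strictZeta C u y
      ≡⟨ cong (_+ strictZeta C u y) (sum-delta (λ x → [ C x ]· u x) y) ⟩
    [ C y ]· u y + strictZeta C u y
      ∎
    where
    open ≡-Reasoning
    split-at-y : ∀ x → [ C x ∧ ⌊ x ≤? y ⌋ ]· u x ≡ [ ⌊ x ≟ y ⌋ ]· [ C x ]· u x + [ C x ∧ x <ᵇ y ]· u x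
    split-at-y x with x ≟ y
    ... | no _ rewrite ∧-identityʳ ⌊ x ≤? y ⌋ = sym (ℤ.+-identityˡ _)
    ... | yes refl with x ≤? x
    ...   | no x≰x = ⊥-elim (x≰x ≤-refl)
    ...   | yes _ with C x
    ...     | true  = sym (ℤ.+-identityʳ (u x))
    ...     | false = refl

  zeta-injective : ∀ C (u v : Fin n → ℤ) → (∀ y → C y ≡ true → zeta C u y ≡ zeta C v y) →
                   ∀ y → C y ≡ true → u y ≡ v y
  zeta-injective C u v zeta-u≡zeta-v y = go y (po-wellFounded isPartialOrder y)
    where
    go : ∀ y → Acc _<_ y → C y ≡ true → u y ≡ v y
    go y (acc below) Cy = ∙-cancelʳ (strictZeta C u y) (u y) (v y) (begin
      u y + strictZeta C u y          ≡⟨ cong (λ b → [ b ]· u y + strictZeta C u y) Cy ⟨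
      [ C y ]· u y + strictZeta C u y ≡⟨ zeta-split C u y ⟨
      zeta C u y                      ≡⟨ zeta-u≡zeta-v y Cy ⟩
      zeta C v y                      ≡⟨ zeta-split C v y ⟩
      [ C y ]· v y + strictZeta C v y ≡⟨ cong (λ b → [ b ]· v y + strictZeta C v y) Cy ⟩
      v y + strictZeta C v y          ≡⟨ cong (v y +_) strictZeta-u≡v ⟨
      v y + strictZeta C u y          ∎)
      where
      open ≡-Reasoning
      strictZeta-u≡v : strictZeta C u y ≡ strictZeta C v y
      strictZeta-u≡v = sum-cong-≗ λ x → []·-cong (C x ∧ x <ᵇ y) λ Cx∧x<y →
        go x (below (<ᵇ⇒< (∧-conicalʳ (C x) _ Cx∧x<y))) (∧-conicalˡ (C x) _ Cx∧x<y)

  zeta-zero : ∀ C y → zeta C (λ _ → 0ℤ) y ≡ 0ℤ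
  zeta-zero C y = trans (sum-cong-≗ λ x → []·-zero (C x ∧ ⌊ x ≤? y ⌋)) (sum-replicate-zero n)

  module Möbius (S : Fin n → Bool) where

    μ : Fin n → Fin n → ℤ
    μ = mobiusSub _≤?_ S

    mobiusFuel-stable : ∀ k x y → height y ℕ.≤ k → mobiusFuel _≤?_ S k x y ≡ mobiusFuel _≤?_ S (suc k) x y
    mobiusFuel-stable k x y hy with x ≟ y
    ... | yes _ = refl
    mobiusFuel-stable zero x y hy | no x≢y with x ≤? y
    ... | yes x≤y = ⊥-elim (ℕₚ.n≮0 (ℕₚ.<-≤-trans (height-mono (x≤y , x≢y)) hy))
    ... | no _    = refl
    mobiusFuel-stable (suc k) x y hy | no x≢y with x ≤? y
    ... | no _    = refl
    ... | yes _   = cong -_ (sumFin-cong λ z → []·-cong (S z ∧ ⌊ x ≤? z ⌋ ∧ z <ᵇ y) λ e →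
      mobiusFuel-stable k x z (height-below (<ᵇ⇒< (∧-conicalʳ ⌊ x ≤? z ⌋ _ (∧-conicalʳ (S z) _ e)))))
      where
      height-below : ∀ {z} → z < y → height z ℕ.≤ k
      height-below z<y = ℕ.s≤s⁻¹ (ℕₚ.<-≤-trans (height-mono z<y) hy)

    mobiusFuel-suc : ∀ k {x y} → x ≤ y → x ≢ y →
      mobiusFuel _≤?_ S (suc k) x y ≡ - sumFin (λ z → [ S z ∧ ⌊ x ≤? z ⌋ ∧ z <ᵇ y ]· mobiusFuel _≤?_ S k x z)
    mobiusFuel-suc k {x} {y} x≤y x≢y with x ≟ y
    ... | yes x≡y = ⊥-elim (x≢y x≡y)
    ... | no _ with x ≤? y
    ...   | yes _   = refl
    ...   | no x≰y  = ⊥-elim (x≰y x≤y)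

    μ-refl : ∀ x → μ x x ≡ 1ℤ
    μ-refl x with x ≟ x
    ... | yes _   = refl
    ... | no x≢x  = ⊥-elim (x≢x refl)

    S-above : Fin n → Fin n → Bool
    S-above x z = S z ∧ ⌊ x ≤? z ⌋

    μ-unfold : ∀ {x y} → x ≤ y → x ≢ y → μ x y ≡ - strictZeta (S-above x) (μ x) y
    μ-unfold {x} {y} x≤y x≢y = begin
      μ x y
        ≡⟨ mobiusFuel-stable n x y (ℕₚ.<⇒≤ (height<n y)) ⟩
      mobiusFuel _≤?_ S (suc n) x y
        ≡⟨ mobiusFuel-suc n x≤y x≢y ⟩
      - sumFin (λ z → [ S z ∧ ⌊ x ≤? z ⌋ ∧ z <ᵇ y ]· μ x z)
        ≡⟨ cong -_ (sumFin≡sum (λ z → [ S z ∧ ⌊ x ≤? z ⌋ ∧ z <ᵇ y ]· μ x z)) ⟩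
      - sum (λ z → [ S z ∧ ⌊ x ≤? z ⌋ ∧ z <ᵇ y ]· μ x z)
        ≡⟨ cong -_ (sum-cong-≗ λ z → cong ([_]· μ x z) (sym (∧-assoc (S z) _ _))) ⟩
      - strictZeta (S-above x) (μ x) y
        ∎
      where open ≡-Reasoning

    strictZeta-μ-self : ∀ x → strictZeta (S-above x) (μ x) x ≡ 0ℤ
    strictZeta-μ-self x = trans (sum-cong-≗ nothing-strictly-between) (sum-replicate-zero n)
      where
      nothing-strictly-between : ∀ z → [ S-above x z ∧ z <ᵇ x ]· μ x z ≡ 0ℤ
      nothing-strictly-between z = []·-vanish _ λ e →
        let (z≤x , z≢x) = <ᵇ⇒< (∧-conicalʳ (S-above x z) _ e)
        in z≢x (antisym z≤x (⌊⌋-true⁻¹ (x ≤? z) (∧-conicalʳ (S z) _ (∧-conicalˡ (S-above x z) _ e))))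

    zeta-μ-split : ∀ {x y} → S y ≡ true → x ≤ y → zeta (S-above x) (μ x) y ≡ μ x y + strictZeta (S-above x) (μ x) y
    zeta-μ-split {x} {y} Sy x≤y = trans (zeta-split (S-above x) (μ x) y)
      (cong (λ b → [ b ]· μ x y + strictZeta (S-above x) (μ x) y) (cong₂ _∧_ Sy (⌊⌋-true (x ≤? y) x≤y)))

    zeta-μ : ∀ {x y} → S y ≡ true → x ≤ y → zeta (S-above x) (μ x) y ≡ [ ⌊ x ≟ y ⌋ ]· 1ℤ
    zeta-μ {x} {y} Sy x≤y with x ≟ y
    ... | yes refl = trans (zeta-μ-split Sy x≤y) (cong₂ _+_ (μ-refl x) (strictZeta-μ-self x))
    ... | no x≢y   = begin
      zeta (S-above x) (μ x) y      ≡⟨ zeta-μ-split Sy x≤y ⟩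
      μ x y + strictSum             ≡⟨ cong (_+ strictSum) (μ-unfold x≤y x≢y) ⟩
      - strictSum + strictSum       ≡⟨ ℤ.+-inverseˡ strictSum ⟩
      0ℤ                            ∎
      where
      open ≡-Reasoning
      strictSum : ℤ
      strictSum = strictZeta (S-above x) (μ x) y

    zeta-μ-from-least : ∀ {⊥̂ y} → (∀ z → ⊥̂ ≤ z) → S y ≡ true → zeta S (μ ⊥̂) y ≡ [ ⌊ ⊥̂ ≟ y ⌋ ]· 1ℤ
    zeta-μ-from-least {⊥̂} {y} ⊥̂≤ Sy = trans (sum-cong-≗ drop-⊥̂≤) (zeta-μ Sy (⊥̂≤ y))
      where
      drop-⊥̂≤ : ∀ z → [ S z ∧ ⌊ z ≤? y ⌋ ]· μ ⊥̂ z ≡ [ S-above ⊥̂ z ∧ ⌊ z ≤? y ⌋ ]· μ ⊥̂ z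
      drop-⊥̂≤ z = cong (λ b → [ b ∧ ⌊ z ≤? y ⌋ ]· μ ⊥̂ z)
        (sym (trans (cong (S z ∧_) (⌊⌋-true (⊥̂ ≤? z) (⊥̂≤ z))) (∧-identityʳ (S z))))

  module Increasing (φ : Fin n → Fin n) (φ-mono : ∀ x y → x ≤ y → φ x ≤ φ y) (φ-inc : ∀ x → x ≤ φ x) where

    iter-inc : ∀ k x → x ≤ iter φ k x
    iter-inc zero    x = ≤-refl
    iter-inc (suc k) x = ≤-trans (iter-inc k x) (φ-inc _)

    iter-mono : ∀ k {x y} → x ≤ y → iter φ k x ≤ iter φ k y
    iter-mono zero    x≤y = x≤y
    iter-mono (suc k) x≤y = φ-mono _ _ (iter-mono k x≤y)

    iter-fixed : ∀ k {y} → φ y ≡ y → iter φ k y ≡ y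
    iter-fixed zero    φy≡y = refl
    iter-fixed (suc k) φy≡y = trans (cong φ (iter-fixed k φy≡y)) φy≡y

    iter-fixed-or-climbing : ∀ k x → φ (iter φ k x) ≡ iter φ k x ⊎ k ℕ.≤ height (iter φ k x)
    iter-fixed-or-climbing zero    x = inj₂ ℕ.z≤n
    iter-fixed-or-climbing (suc k) x with iter-fixed-or-climbing k x
    ... | inj₁ fixed = inj₁ (cong φ fixed)
    ... | inj₂ k≤height with φ (iter φ k x) ≟ iter φ k x
    ...   | yes fixed = inj₁ (cong φ fixed)
    ...   | no moved  = inj₂ (ℕₚ.≤-<-trans k≤height (height-mono (φ-inc _ , moved ∘ sym)))

    φ^∞ : Fin n → Fin n
    φ^∞ = iter φ n

    φ^∞-fixed : ∀ x → φ (φ^∞ x) ≡ φ^∞ x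
    φ^∞-fixed x with iter-fixed-or-climbing n x
    ... | inj₁ fixed    = fixed
    ... | inj₂ n≤height = ⊥-elim (ℕₚ.<⇒≱ (height<n (φ^∞ x)) n≤height)

    φ^∞-≤-fixed : ∀ {y} → φ y ≡ y → ∀ z → (φ^∞ z ≤ y) ⇔ (z ≤ y)
    φ^∞-≤-fixed φy≡y z = mk⇔ (≤-trans (iter-inc n z)) (λ z≤y → subst (φ^∞ z ≤_) (iter-fixed n φy≡y) (iter-mono n z≤y))

    Fix : Fin n → Bool
    Fix x = ⌊ φ x ≟ x ⌋

    pushforward : (Fin n → Bool) → (Fin n → ℤ) → Fin n → ℤ
    pushforward P g x = sum (λ z → [ P z ∧ ⌊ φ^∞ z ≟ x ⌋ ]· g z)

    zeta-pushforward : ∀ P g {y} → φ y ≡ y → zeta Fix (pushforward P g) y ≡ zeta P g y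
    zeta-pushforward P g {y} φy≡y = begin
      sum (λ x → [ Fix x ∧ ⌊ x ≤? y ⌋ ]· sum (λ z → [ P z ∧ ⌊ φ^∞ z ≟ x ⌋ ]· g z))
        ≡⟨ sum-cong-≗ (λ x → []·-sum (Fix x ∧ ⌊ x ≤? y ⌋) (λ z → [ P z ∧ ⌊ φ^∞ z ≟ x ⌋ ]· g z)) ⟩
      sum (λ x → sum (λ z → term x z))
        ≡⟨ ∑-comm term ⟩
      sum (λ z → sum (λ x → term x z))
        ≡⟨ sum-cong-≗ (λ z → sum-supported-at (λ x → term x z) (φ^∞ z) (term-off-φ^∞ z)) ⟩
      sum (λ z → term (φ^∞ z) z)
        ≡⟨ sum-cong-≗ term-at-φ^∞ ⟩
      sum (λ z → [ P z ∧ ⌊ z ≤? y ⌋ ]· g z)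
        ∎
      where
      open ≡-Reasoning
      term : Fin n → Fin n → ℤ
      term x z = [ Fix x ∧ ⌊ x ≤? y ⌋ ]· [ P z ∧ ⌊ φ^∞ z ≟ x ⌋ ]· g z

      term-off-φ^∞ : ∀ z x → x ≢ φ^∞ z → term x z ≡ 0ℤ
      term-off-φ^∞ z x x≢φ^∞z with φ^∞ z ≟ x
      ... | yes φ^∞z≡x = ⊥-elim (x≢φ^∞z (sym φ^∞z≡x))
      ... | no _ rewrite ∧-zeroʳ (P z) = []·-zero (Fix x ∧ ⌊ x ≤? y ⌋)

      term-at-φ^∞ : ∀ z → term (φ^∞ z) z ≡ [ P z ∧ ⌊ z ≤? y ⌋ ]· g z
      term-at-φ^∞ z
        rewrite ⌊⌋-true (φ (φ^∞ z) ≟ φ^∞ z) (φ^∞-fixed z)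
              | ⌊⌋-true (φ^∞ z ≟ φ^∞ z) refl
              | ⌊⌋-⇔ (φ^∞-≤-fixed φy≡y z) (φ^∞ z ≤? y) (z ≤? y)
              | ∧-identityʳ (P z)
              = sym ([]·-∧ (P z) ⌊ z ≤? y ⌋ (g z))

    pushforward-singleton : ∀ P g w → (∀ z → (P z ≡ true × φ^∞ z ≡ w) ⇔ z ≡ w) → pushforward P g w ≡ g w
    pushforward-singleton P g w only-w = trans (sum-supported-at (λ z → [ P z ∧ ⌊ φ^∞ z ≟ w ⌋ ]· g z) w off-w) at-w
      where
      off-w : ∀ z → z ≢ w → [ P z ∧ ⌊ φ^∞ z ≟ w ⌋ ]· g z ≡ 0ℤ
      off-w z z≢w = []·-vanish (P z ∧ ⌊ φ^∞ z ≟ w ⌋) λ e →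
        z≢w (Equivalence.to (only-w z) (∧-conicalˡ (P z) _ e , ⌊⌋-true⁻¹ (φ^∞ z ≟ w) (∧-conicalʳ (P z) _ e)))
      at-w : [ P w ∧ ⌊ φ^∞ w ≟ w ⌋ ]· g w ≡ g w
      at-w = let (Pw , φ^∞w≡w) = Equivalence.from (only-w w) refl
             in cong (λ b → [ b ]· g w) (cong₂ _∧_ Pw (⌊⌋-true (φ^∞ w ≟ w) φ^∞w≡w))

    module _ {⊥̂ : Fin n} (⊥̂≤ : ∀ z → ⊥̂ ≤ z) (S : Fin n → Bool) (Fix⊆S : ∀ z → φ z ≡ z → S z ≡ true) where

      open Möbius S using (μ; zeta-μ-from-least)

      zeta-pushforward-μ : ∀ y → Fix y ≡ true → zeta Fix (pushforward S (μ ⊥̂)) y ≡ [ ⌊ ⊥̂ ≟ y ⌋ ]· 1ℤ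
      zeta-pushforward-μ y Fix-y = trans (zeta-pushforward S (μ ⊥̂) φy≡y) (zeta-μ-from-least ⊥̂≤ (Fix⊆S y φy≡y))
        where
        φy≡y : φ y ≡ y
        φy≡y = ⌊⌋-true⁻¹ (φ y ≟ y) Fix-y

      pushforward-μ-vanishes : φ ⊥̂ ≢ ⊥̂ → ∀ {y} → φ y ≡ y → pushforward S (μ ⊥̂) y ≡ 0ℤ
      pushforward-μ-vanishes φ⊥̂≢⊥̂ {y} φy≡y =
        zeta-injective Fix (pushforward S (μ ⊥̂)) (λ _ → 0ℤ) zeta≡0 y (⌊⌋-true (φ y ≟ y) φy≡y)
        where
        zeta≡0 : ∀ w → Fix w ≡ true → zeta Fix (pushforward S (μ ⊥̂)) w ≡ zeta Fix (λ _ → 0ℤ) w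
        zeta≡0 w Fix-w = trans (zeta-pushforward-μ w Fix-w) (trans ([]·-vanish ⌊ ⊥̂ ≟ w ⌋ ⊥̂≢w) (sym (zeta-zero Fix w)))
          where
          ⊥̂≢w : ¬ ⌊ ⊥̂ ≟ w ⌋ ≡ true
          ⊥̂≢w e = φ⊥̂≢⊥̂ (subst (λ v → φ v ≡ v) (sym (⌊⌋-true⁻¹ (⊥̂ ≟ w) e)) (⌊⌋-true⁻¹ (φ w ≟ w) Fix-w))

    pushforward-μ-independent : ∀ {⊥̂} (⊥̂≤ : ∀ z → ⊥̂ ≤ z) S S′ →
      (∀ z → φ z ≡ z → S z ≡ true) → (∀ z → φ z ≡ z → S′ z ≡ true) →
      ∀ {y} → φ y ≡ y → pushforward S (Möbius.μ S ⊥̂) y ≡ pushforward S′ (Möbius.μ S′ ⊥̂) y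
    pushforward-μ-independent ⊥̂≤ S S′ Fix⊆S Fix⊆S′ {y} φy≡y =
      zeta-injective Fix _ _
        (λ w Fix-w → trans (zeta-pushforward-μ ⊥̂≤ S Fix⊆S w Fix-w) (sym (zeta-pushforward-μ ⊥̂≤ S′ Fix⊆S′ w Fix-w)))
        y (⌊⌋-true (φ y ≟ y) φy≡y)

corollary3p4 : (n : ℕ) (_≤_ : Rel (Fin n) 0ℓ) (po : IsDecPartialOrder _≡_ _≤_)
    (bot top : Fin n) → (∀ x → bot ≤ x) → (∀ x → x ≤ top) →
    (φ : Fin n → Fin n) → (∀ x y → x ≤ y → φ x ≤ φ y) → (∀ x → x ≤ φ x) →
    (Q : Fin n → Bool) →
    (∀ z → φ z ≡ z → Q z ≡ true) →
    (∀ z → ((Q z ≡ true) × (iter φ n z ≡ top)) ⇔ (z ≡ top)) →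
    let _≤?_ = IsDecPartialOrder._≤?_ po
        lhs = sumFin (λ z → if ⌊ iter φ n z ≟ top ⌋ then mobius _≤?_ bot z else 0ℤ)
    in ((φ bot ≡ bot) → lhs ≡ mobiusSub _≤?_ Q bot top)
       × ((φ bot ≢ bot) → lhs ≡ 0ℤ)
corollary3p4 n _≤_ po bot top bot≤ ≤top φ φ-mono φ-inc Q Fix⊆Q Q∩φ^∞⁻¹[top] =
  (λ _ → begin
    sumFin (λ z → [ ⌊ φ^∞ z ≟ top ⌋ ]· μ everything bot z)
      ≡⟨ sumFin≡sum (λ z → [ ⌊ φ^∞ z ≟ top ⌋ ]· μ everything bot z) ⟩
    pushforward everything (μ everything bot) top
      ≡⟨ pushforward-μ-independent bot≤ everything Q (λ _ _ → refl) Fix⊆Q top-fixed ⟩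
    pushforward Q (μ Q bot) top
      ≡⟨ pushforward-singleton Q (μ Q bot) top Q∩φ^∞⁻¹[top] ⟩
    μ Q bot top
      ∎) ,
  (λ φbot≢bot → trans (sumFin≡sum (λ z → [ ⌊ φ^∞ z ≟ top ⌋ ]· μ everything bot z))
                      (pushforward-μ-vanishes bot≤ everything (λ _ _ → refl) φbot≢bot top-fixed))
  where
  open FiniteDecPoset po
  open Increasing φ φ-mono φ-inc
  open IsDecPartialOrder po using (antisym)
  open Möbius using (μ)
  open ≡-Reasoning

  everything : Fin n → Bool
  everything _ = true

  top-fixed : φ top ≡ top
  top-fixed = antisym (≤top (φ top)) (φ-inc top)
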